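{- The process $\mathsf{Process\_instruction}$ (defined in the context) satisfies \texttt{positive bid-ask spread}, \texttt{price-time priority} and \texttt{conservation}.
   Context: An order is a 4-tuple $\omega=(\mathsf{id}(\omega),\mathsf{timestamp}(\omega),\mathsf{qty}(\omega),\mathsf{price}(\omega))$ of natural numbers with $\mathsf{qty}(\omega)>0$. An order-domain is a pair $(B,A)$ of finite sets of orders ($B$ = bids, $A$ = asks); it is admissible if all orders in $B\cup A$ have pairwise distinct ids and pairwise distinct timestamps. A bid $b$ and ask $a$ are tradable if $\mathsf{price}(b)\ge\mathsf{price}(a)$; $(B,A)$ is matchable if some $b\in B$, $a\in A$ are tradable. Competitiveness: bid $b_1\succ b_2$ iff $\mathsf{price}(b_1)>\mathsf{price}(b_2)$, or prices equal and $\mathsf{timestamp}(b_1)<\mathsf{timestamp}(b_2)$; ask $a_1\succ a_2$ iff $\mathsf{price}(a_1)<\mathsf{price}(a_2)$, or prices equal and $\mathsf{timestamp}(a_1)<\mathsf{timestamp}(a_2)$. A transaction is a triple $t=(\mathsf{id_{bid}}(t),\mathsf{id_{ask}}(t),\mathsf{qty}(t))$ of natural numbers with $\mathsf{qty}(t)>0$; it is valid w.r.t. $(B,A)$ if there are $b\in B$, $a\in A$ with $\mathsf{id_{bid}}(t)=\mathsf{id}(b)$, $\mathsf{id_{ask}}(t)=\mathsf{id}(a)$, $b,a$ tradable, and $\mathsf{qty}(t)\le\min(\mathsf{qty}(b),\mathsf{qty}(a))$. $\mathsf{Qty}(T,id)$ is the sum of quantities of transactions in $T$ whose bid id (for a bid)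 resp. ask id (for an ask) equals $id$; $\mathsf{ids_{bid}}(T),\mathsf{ids_{ask}}(T)$ are the sets of bid/ask ids in $T$. A matching over an admissible $(B,A)$ is a set $M$ of valid transactions with $\mathsf{Qty}(M,\mathsf{id}(\omega))\le\mathsf{qty}(\omega)$ for all $\omega\in B\cup A$. $\mathsf{Bids}(M,B)$ is the set of bids of $B$ occurring in $M$ with quantity replaced by $\mathsf{Qty}(M,\mathsf{id}(b))$; $\mathsf{Asks}(M,A)$ likewise. Sets of orders are viewed as multisets (each order, quantity suppressed, with multiplicity its quantity); $S_1-S_2$ is multiset difference. An instruction is $\mathsf{Buy}\ \beta$, $\mathsf{Sell}\ \alpha$ or $\mathsf{Del}\ id$. $\mathsf{Absorb}(B,A,\mathsf{Del}\ id)=(\{b\in B:\mathsf{id}(b)\ne id\},\{a\in A:\mathsf{id}(a)\ne id\})$, $\mathsf{Absorb}(B,A,\mathsf{Buy}\ \beta)=(B\cup\{\beta\},A)$, $\mathsf{Absorb}(B,A,\mathsf{Sell}\ \alpha)=(B,A\cup\{\alpha\})$. $((B,A),\tau)$ is a legal-input if $(B,A)$ is not matchable and $\mathsf{Absorb}(B,A,\tau)$ is admissible. A process is a function $P:(B,A,\tau)\mapsto(\hat B,\hat A,M)$. For every legal-input with $P(B,A,\tau)=(\hat B,\hat A,M)$ and $(B',A')=\mathsf{Absorb}(B,A,\tau)$, $P$ satisfies: \texttt{positive bid-ask spread} if $(\hat B,\hat A)$ is not matchable; \texttt{price-time priority} if for all $a,a'\in A'$ with $a\succ a'$ and $\mathsf{id}(a')\in\mathsf{ids_{ask}}(M)$,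 $\mathsf{Qty}(M,\mathsf{id}(a))=\mathsf{qty}(a)$, and for all $b,b'\in B'$ with $b\succ b'$ and $\mathsf{id}(b')\in\mathsf{ids_{bid}}(M)$, $\mathsf{Qty}(M,\mathsf{id}(b))=\mathsf{qty}(b)$; \texttt{conservation} if $M$ is a matching over $(B',A')$, $\hat B=B'-\mathsf{Bids}(M,B')$, $\hat A=A'-\mathsf{Asks}(M,A')$. A process satisfies a property if it does so for all legal-inputs. The algorithm: $\mathsf{Process\_instruction}(B,A,\mathsf{Buy}\ \beta)=\mathsf{Match\_Bid}(B,A,\beta)$, $\mathsf{Process\_instruction}(B,A,\mathsf{Sell}\ \alpha)=\mathsf{Match\_Ask}(B,A,\alpha)$, $\mathsf{Process\_instruction}(B,A,\mathsf{Del}\ id)=\mathsf{Del\_Order}(B,A,id)=(\{b\in B:\mathsf{id}(b)\ne id\},\{a\in A:\mathsf{id}(a)\ne id\},\emptyset)$. $\mathsf{Match\_Ask}(B,A,\alpha)$: if $B=\emptyset$ return $(B,A\cup\{\alpha\},\emptyset)$. Otherwise let $\beta$ be the most competitive bid in $B$. If $\beta,\alpha$ are not tradable, return $(B,A\cup\{\alpha\},\emptyset)$. If $\mathsf{qty}(\beta)=\mathsf{qty}(\alpha)$, return $(B\setminus\{\beta\},A,\{(\mathsf{id}(\beta),\mathsf{id}(\alpha),\mathsf{qty}(\alpha))\})$. If $\mathsf{qty}(\beta)>\mathsf{qty}(\alpha)$, return $((B\setminus\{\beta\})\cup\{\beta'\},A,\{(\mathsf{id}(\beta),\mathsf{id}(\alpha),\mathsf{qty}(\alpha))\})$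 where $\beta'$ equals $\beta$ except $\mathsf{qty}(\beta')=\mathsf{qty}(\beta)-\mathsf{qty}(\alpha)$. If $\mathsf{qty}(\beta)<\mathsf{qty}(\alpha)$, let $\alpha'$ equal $\alpha$ except $\mathsf{qty}(\alpha')=\mathsf{qty}(\alpha)-\mathsf{qty}(\beta)$, compute $(B'',A'',M'')=\mathsf{Match\_Ask}(B\setminus\{\beta\},A,\alpha')$ and return $(B'',A'',M''\cup\{(\mathsf{id}(\beta),\mathsf{id}(\alpha),\mathsf{qty}(\beta))\})$. $\mathsf{Match\_Bid}(B,A,\beta)$ is the symmetric procedure with roles of bids and asks exchanged (matching the incoming bid $\beta$ against the most competitive ask in $A$, recursively, with transactions $(\mathsf{id}(\beta),\mathsf{id}(a),q)$). -}

module Defs where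

open import Data.Nat using (ℕ; zero; suc; _+_; _∸_; _⊓_; _≤_; _<_; _≤?_; _<?_; _≟_; z≤n; s≤s)
open import Data.Nat.Properties using (<-cmp; m≤m+n; ≤-trans; +-monoʳ-≤; m≤n+m; m<n⇒0<n∸m)
open import Data.Product using (Σ; ∃; ∃-syntax; _×_; _,_; proj₁; proj₂)
open import Data.Product.Properties using () renaming (≡-dec to ×-≡-dec)
open import Data.Sum using (_⊎_; inj₁; inj₂)
open import Data.List using (List; []; _∷_; _++_; map; filter; deduplicate; length; [_])
open import Data.Nat.ListAction using (sum)
open import Data.List.Membership.DecPropositional _≟_ using () renaming (_∈?_ to _∈ℕ?_)
open import Data.List.Membership.Propositional using (_∈_)
open import Data.List.Membership.Propositional.Properties using (∈-map⁻; ∈-deduplicate⁺; ∈-filter⁺)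
open import Data.List.Relation.Unary.Any using (here; there)
open import Relation.Binary.PropositionalEquality using (_≡_; _≢_; refl; cong; sym)
open import Relation.Binary.Definitions using (DecidableEquality; tri<; tri≈; tri>)
open import Relation.Nullary using (Dec; yes; no; ¬_; ¬?; _×-dec_; _⊎-dec_)

record Order : Set where
  constructor order
  field
    id        : ℕ
    timestamp : ℕ
    qty       : ℕ
    price     : ℕ
    .qty-pos  : 0 < qty

record Transaction : Set where
  constructor transaction
  field
    idBid   : ℕ
    idAsk   : ℕ
    qty     : ℕ
    .qty-pos : 0 < qty

open Order public
open Transaction public renaming (qty to tqty; qty-pos to tqty-pos)

_≟ₒ_ : DecidableEquality Order
order i t q p _ ≟ₒ order i' t' q' p' _ with i ≟ i' | t ≟ t' | q ≟ q' | p ≟ p'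
... | yes refl | yes refl | yes refl | yes refl = yes refl
... | no ne | _ | _ | _ = no λ e → ne (cong id e)
... | yes _ | no ne | _ | _ = no λ e → ne (cong timestamp e)
... | yes _ | yes _ | no ne | _ = no λ e → ne (cong qty e)
... | yes _ | yes _ | yes _ | no ne = no λ e → ne (cong price e)

_≟ₜ_ : DecidableEquality Transaction
transaction i j q _ ≟ₜ transaction i' j' q' _ with i ≟ i' | j ≟ j' | q ≟ q'
... | yes refl | yes refl | yes refl = yes refl
... | no ne | _ | _ = no λ e → ne (cong idBid e)
... | yes _ | no ne | _ = no λ e → ne (cong idAsk e)
... | yes _ | yes _ | no ne = no λ e → ne (cong tqty e)

-- Finite sets are represented by lists, read as sets: every notion
-- below depends only on list membership, or (for sums / multiplicities)
-- on the duplicate-free version  deduplicate  of the list.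

Admissible : List Order → List Order → Set
Admissible B A = ∀ {x y} → x ∈ B ++ A → y ∈ B ++ A → x ≢ y →
                 (id x ≢ id y) × (timestamp x ≢ timestamp y)

Tradable : Order → Order → Set
Tradable b a = price a ≤ price b

Matchable : List Order → List Order → Set
Matchable B A = ∃[ b ] ∃[ a ] (b ∈ B × a ∈ A × Tradable b a)

_≻ᵇ_ : Order → Order → Set
b₁ ≻ᵇ b₂ = (price b₂ < price b₁) ⊎ (price b₁ ≡ price b₂ × timestamp b₁ < timestamp b₂)

_≻ᵃ_ : Order → Order → Set
a₁ ≻ᵃ a₂ = (price a₁ < price a₂) ⊎ (price a₁ ≡ price a₂ × timestamp a₁ < timestamp a₂)

_≻ᵇ?_ : (b₁ b₂ : Order) → Dec (b₁ ≻ᵇ b₂)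
b₁ ≻ᵇ? b₂ = (price b₂ <? price b₁) ⊎-dec ((price b₁ ≟ price b₂) ×-dec (timestamp b₁ <? timestamp b₂))

_≻ᵃ?_ : (a₁ a₂ : Order) → Dec (a₁ ≻ᵃ a₂)
a₁ ≻ᵃ? a₂ = (price a₁ <? price a₂) ⊎-dec ((price a₁ ≟ price a₂) ×-dec (timestamp a₁ <? timestamp a₂))

Valid : Transaction → List Order → List Order → Set
Valid t B A = ∃[ b ] ∃[ a ] (b ∈ B × a ∈ A × idBid t ≡ id b × idAsk t ≡ id a ×
                              Tradable b a × tqty t ≤ qty b ⊓ qty a)

QtyBid : List Transaction → ℕ → ℕ
QtyBid T i = sum (map tqty (filter (λ t → idBid t ≟ i) (deduplicate _≟ₜ_ T)))

QtyAsk : List Transaction → ℕ → ℕ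
QtyAsk T i = sum (map tqty (filter (λ t → idAsk t ≟ i) (deduplicate _≟ₜ_ T)))

idsBid : List Transaction → List ℕ
idsBid T = map idBid T

idsAsk : List Transaction → List ℕ
idsAsk T = map idAsk T

Matching : List Transaction → List Order → List Order → Set
Matching M B A = (∀ {t} → t ∈ M → Valid t B A) ×
                 (∀ {b} → b ∈ B → QtyBid M (id b) ≤ qty b) ×
                 (∀ {a} → a ∈ A → QtyAsk M (id a) ≤ qty a)

private
  ∈⇒≤sum : ∀ {x : Transaction} {xs} → x ∈ xs → tqty x ≤ sum (map tqty xs)
  ∈⇒≤sum {xs = y ∷ ys} (here refl) = m≤m+n (tqty y) _
  ∈⇒≤sum {xs = y ∷ ys} (there p) = ≤-trans (∈⇒≤sum p) (m≤n+m _ (tqty y))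

  pos : ∀ (t : Transaction) → 0 < tqty t
  pos (transaction _ _ (suc q) _) = s≤s z≤n

occurs⇒QtyBid-pos : ∀ T i → i ∈ idsBid T → 0 < QtyBid T i
occurs⇒QtyBid-pos T i p with ∈-map⁻ idBid p
... | t , t∈T , refl =
  ≤-trans (pos t) (∈⇒≤sum (∈-filter⁺ (λ u → idBid u ≟ idBid t) (∈-deduplicate⁺ _≟ₜ_ t∈T) refl))

occurs⇒QtyAsk-pos : ∀ T i → i ∈ idsAsk T → 0 < QtyAsk T i
occurs⇒QtyAsk-pos T i p with ∈-map⁻ idAsk p
... | t , t∈T , refl =
  ≤-trans (pos t) (∈⇒≤sum (∈-filter⁺ (λ u → idAsk u ≟ idAsk t) (∈-deduplicate⁺ _≟ₜ_ t∈T) refl))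

Bids : List Transaction → List Order → List Order
Bids M [] = []
Bids M (b ∷ bs) with id b ∈ℕ? idsBid M
... | yes p = order (id b) (timestamp b) (QtyBid M (id b)) (price b) (occurs⇒QtyBid-pos M (id b) p) ∷ Bids M bs
... | no _  = Bids M bs

Asks : List Transaction → List Order → List Order
Asks M [] = []
Asks M (a ∷ as) with id a ∈ℕ? idsAsk M
... | yes p = order (id a) (timestamp a) (QtyAsk M (id a)) (price a) (occurs⇒QtyAsk-pos M (id a) p) ∷ Asks M as
... | no _  = Asks M as

-- Sets of orders viewed as multisets: an order with quantity suppressed
-- is its key (id, timestamp, price); its multiplicity is its quantity.
Key : Set
Key = ℕ × ℕ × ℕ

key : Order → Key
key o = id o , timestamp o , price o

_≟ₖ_ : DecidableEquality Key
_≟ₖ_ = ×-≡-dec _≟_ (×-≡-dec _≟_ _≟_)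

mult : List Order → Key → ℕ
mult S k = sum (map qty (filter (λ o → key o ≟ₖ k) (deduplicate _≟ₒ_ S)))

_≡ₘ_-ₘ_ : List Order → List Order → List Order → Set
S₁ ≡ₘ S₂ -ₘ S₃ = ∀ k → mult S₁ k ≡ mult S₂ k ∸ mult S₃ k

data Instruction : Set where
  Buy  : Order → Instruction
  Sell : Order → Instruction
  Del  : ℕ → Instruction

removeId : ℕ → List Order → List Order
removeId i S = filter (λ o → ¬? (id o ≟ i)) S

Absorb : List Order → List Order → Instruction → List Order × List Order
Absorb B A (Del i)  = removeId i B , removeId i A
Absorb B A (Buy β)  = β ∷ B , A
Absorb B A (Sell α) = B , α ∷ A

LegalInput : List Order → List Order → Instruction → Set
LegalInput B A τ = ¬ Matchable B A × Admissible (proj₁ (Absorb B A τ)) (proj₂ (Absorb B A τ))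

Process : Set
Process = List Order → List Order → Instruction → List Order × List Order × List Transaction

PositiveBidAskSpread : Process → Set
PositiveBidAskSpread P = ∀ B A τ → LegalInput B A τ →
  let (B̂ , Â , M) = P B A τ in ¬ Matchable B̂ Â

PriceTimePriority : Process → Set
PriceTimePriority P = ∀ B A τ → LegalInput B A τ →
  let (B̂ , Â , M) = P B A τ
      (B' , A') = Absorb B A τ
  in (∀ {a a'} → a ∈ A' → a' ∈ A' → a ≻ᵃ a' → id a' ∈ idsAsk M → QtyAsk M (id a) ≡ qty a) ×
     (∀ {b b'} → b ∈ B' → b' ∈ B' → b ≻ᵇ b' → id b' ∈ idsBid M → QtyBid M (id b) ≡ qty b)

Conservation : Process → Set
Conservation P = ∀ B A τ → LegalInput B A τ →
  let (B̂ , Â , M) = P B A τ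
      (B' , A') = Absorb B A τ
  in Matching M B' A' × (B̂ ≡ₘ B' -ₘ Bids M B') × (Â ≡ₘ A' -ₘ Asks M A')

remove : Order → List Order → List Order
remove o S = filter (λ x → ¬? (x ≟ₒ o)) S

bestBid : Order → List Order → Order
bestBid c [] = c
bestBid c (x ∷ xs) with x ≻ᵇ? c
... | yes _ = bestBid x xs
... | no _  = bestBid c xs

bestAsk : Order → List Order → Order
bestAsk c [] = c
bestAsk c (x ∷ xs) with x ≻ᵃ? c
... | yes _ = bestAsk x xs
... | no _  = bestAsk c xs

Result : Set
Result = List Order × List Order × List Transaction

-- The first argument is fuel, instantiated with length B; each
-- recursive call removes the best bid (an element of B), so the fuel
-- is exhausted only when B = ∅, where the result coincides with the
-- B = ∅ clause of the paper.
matchAsk : ℕ → List Order → List Order → Order → Result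
matchAsk zero B A α = B , α ∷ A , []
matchAsk (suc n) [] A α = [] , α ∷ A , []
matchAsk (suc n) B@(b ∷ bs) A α@(order ia ta qa pa qa>0) with bestBid b bs
... | β@(order ib tb qb pb qb>0) with pa ≤? pb
...   | no _ = B , α ∷ A , []
...   | yes _ with <-cmp qb qa
...     | tri≈ _ _ _ = remove β B , A , [ transaction ib ia qa qa>0 ]
...     | tri> _ _ qa<qb =
            order ib tb (qb ∸ qa) pb (m<n⇒0<n∸m qa<qb) ∷ remove β B , A , [ transaction ib ia qa qa>0 ]
...     | tri< qb<qa _ _ =
            let (B'' , A'' , M'') = matchAsk n (remove β B) A (order ia ta (qa ∸ qb) pa (m<n⇒0<n∸m qb<qa))
            in B'' , A'' , transaction ib ia qb qb>0 ∷ M''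

matchBid : ℕ → List Order → List Order → Order → Result
matchBid zero B A β = β ∷ B , A , []
matchBid (suc n) B [] β = β ∷ B , [] , []
matchBid (suc n) B A@(a ∷ as) β@(order ib tb qb pb qb>0) with bestAsk a as
... | α@(order ia ta qa pa qa>0) with pa ≤? pb
...   | no _ = β ∷ B , A , []
...   | yes _ with <-cmp qa qb
...     | tri≈ _ _ _ = B , remove α A , [ transaction ib ia qb qb>0 ]
...     | tri> _ _ qb<qa =
            B , order ia ta (qa ∸ qb) pa (m<n⇒0<n∸m qb<qa) ∷ remove α A , [ transaction ib ia qb qb>0 ]
...     | tri< qa<qb _ _ =
            let (B'' , A'' , M'') = matchBid n B (remove α A) (order ib tb (qb ∸ qa) pb (m<n⇒0<n∸m qa<qb))
            in B'' , A'' , transaction ib ia qa qa>0 ∷ M''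

Match-Ask : List Order → List Order → Order → Result
Match-Ask B A α = matchAsk (length B) B A α

Match-Bid : List Order → List Order → Order → Result
Match-Bid B A β = matchBid (length A) B A β

Del-Order : List Order → List Order → ℕ → Result
Del-Order B A i = removeId i B , removeId i A , []

Process-instruction : Process
Process-instruction B A (Buy β)  = Match-Bid B A β
Process-instruction B A (Sell α) = Match-Ask B A α
Process-instruction B A (Del i)  = Del-Order B A i

module Submission where

-- Match_Ask and Match_Bid are two instances of one procedure (Matching.match):
-- the incoming order trades with the most competitive resting order of the
-- opposite book for as long as the two are tradable. Starting from an uncrossed
-- book with unique ids, every trade exhausts the resting order or the incoming
-- one, and only in the second case does the procedure recurse, on a smaller
-- book and a reduced incoming order that satisfy the same invariant.
-- Conservation is then bookkeeping per id, one trade at a time. Priority holds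
-- because the resting order traded is always the best one left and is exhausted
-- before the next one is touched, while an order more competitive than a traded
-- incoming order would already have crossed the book. The spread stays positive
-- because matching stops only when the best resting order no longer trades.

open import Defs
open import Data.Nat using (ℕ; zero; suc; _+_; _∸_; _⊓_; _≤_; _<_; _≟_; _≤?_; z≤n)
open import Data.Nat.Properties
open import Data.Product using (∃-syntax; _×_; _,_; proj₁; proj₂)
open import Data.Sum using (_⊎_; inj₁; inj₂)
open import Data.Empty using (⊥-elim)
open import Data.List using (List; []; _∷_; _++_; map; filter; deduplicate; [_]; length)
open import Data.List.Properties using (filter-all; filter-none; filter-accept; filter-reject; filter-notAll)
open import Data.Nat.ListAction using (sum)
open import Data.List.Membership.Propositional using (_∈_; _∉_; find; lose)
open import Data.List.Membership.Propositional.Properties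
open import Data.List.Membership.DecPropositional _≟_ using () renaming (_∈?_ to _∈ℕ?_)
open import Data.List.Relation.Unary.Any as Any using (here; there; any?)
open import Data.List.Relation.Unary.All as All using (_∷_)
open import Data.List.Relation.Unary.AllPairs using (_∷_)
open import Data.List.Relation.Unary.Unique.Propositional using (Unique)
open import Data.List.Relation.Unary.Unique.DecPropositional.Properties using (deduplicate-!)
open import Relation.Binary.PropositionalEquality hiding ([_])
open import Relation.Binary.Core using (Rel)
open import Relation.Binary.Definitions using (DecidableEquality; tri<; tri≈; tri>) renaming (Decidable to Decidable₂)
open import Relation.Binary.Structures using (IsStrictTotalOrder)
open import Data.Product.Relation.Binary.Pointwise.NonDependent using (Pointwise)
open import Data.Product.Relation.Binary.Lex.Strict using (×-isStrictTotalOrder)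
import Relation.Binary.Construct.On as On
import Relation.Binary.Construct.Flip.EqAndOrd as Flip
open import Relation.Unary using (Pred; Decidable)
open import Relation.Nullary using (¬_; yes; no; ¬?)
open import Level using (0ℓ)
open import Function using (_∘_; _on_; case_of_)

module DedupSum {X : Set} (_≟x_ : DecidableEquality X) {P : Pred X 0ℓ} (P? : Decidable P) (f : X → ℕ) where

  dsum : List X → ℕ
  dsum xs = sum (map f (filter P? (deduplicate _≟x_ xs)))

  filter-unique : ∀ {x ys} → Unique ys → x ∈ ys → P x → (∀ {y} → y ∈ ys → P y → y ≡ x) →
                  filter P? ys ≡ [ x ]
  filter-unique {ys = y ∷ ys} (y∉ys ∷ u) x∈ px only with P? y
  ... | yes py with only (here refl) py
  ...   | refl = cong (y ∷_) (filter-none P? (All.tabulate λ z∈ pz → All.lookup y∉ys z∈ (sym (only (there z∈) pz))))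
  filter-unique (_ ∷ _) (here refl) px only | no ¬py = ⊥-elim (¬py px)
  filter-unique (_ ∷ u) (there x∈) px only | no _ = filter-unique u x∈ px (only ∘ there)

  dsum-none : ∀ {xs} → (∀ {y} → y ∈ xs → ¬ P y) → dsum xs ≡ 0
  dsum-none {xs} none = cong (sum ∘ map f)
    (filter-none P? (All.tabulate λ y∈ → none (∈-deduplicate⁻ _≟x_ xs y∈)))

  dsum-unique : ∀ {x xs} → x ∈ xs → P x → (∀ {y} → y ∈ xs → P y → y ≡ x) → dsum xs ≡ f x
  dsum-unique {x} {xs} x∈ px only =
    trans (cong (sum ∘ map f) (filter-unique (deduplicate-! _≟x_ xs) (∈-deduplicate⁺ _≟x_ x∈) px
                                 λ y∈ → only (∈-deduplicate⁻ _≟x_ xs y∈)))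
          (+-identityʳ (f x))

  deduplicate-fresh : ∀ {x xs} → x ∉ xs → deduplicate _≟x_ (x ∷ xs) ≡ x ∷ deduplicate _≟x_ xs
  deduplicate-fresh {x} {xs} x∉ = cong (x ∷_) (filter-all (λ y → ¬? (x ≟x y))
    (All.tabulate λ y∈ x≡y → x∉ (subst (_∈ xs) (sym x≡y) (∈-deduplicate⁻ _≟x_ xs y∈))))

  dsum-∷-accept : ∀ {x xs} → x ∉ xs → P x → dsum (x ∷ xs) ≡ f x + dsum xs
  dsum-∷-accept x∉ px = trans (cong (sum ∘ map f ∘ filter P?) (deduplicate-fresh x∉))
                               (cong (sum ∘ map f) (filter-accept P? px))

  dsum-∷-reject : ∀ {x xs} → x ∉ xs → ¬ P x → dsum (x ∷ xs) ≡ dsum xs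
  dsum-∷-reject x∉ ¬px = trans (cong (sum ∘ map f ∘ filter P?) (deduplicate-fresh x∉))
                                (cong (sum ∘ map f) (filter-reject P? ¬px))

Qty : (Transaction → ℕ) → List Transaction → ℕ → ℕ
Qty side T i = sum (map tqty (filter (λ t → side t ≟ i) (deduplicate _≟ₜ_ T)))

module _ (side : Transaction → ℕ) {i : ℕ} where
  open DedupSum _≟ₜ_ (λ t → side t ≟ i) tqty

  Qty-∷-hit : ∀ {t M} → t ∉ M → side t ≡ i → Qty side (t ∷ M) i ≡ tqty t + Qty side M i
  Qty-∷-hit = dsum-∷-accept

  Qty-∷-miss : ∀ {t M} → t ∉ M → side t ≢ i → Qty side (t ∷ M) i ≡ Qty side M i
  Qty-∷-miss = dsum-∷-reject

  Qty-none : ∀ {M} → (∀ {t} → t ∈ M → side t ≢ i) → Qty side M i ≡ 0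
  Qty-none = dsum-none

UniqueIds : List Order → Set
UniqueIds S = ∀ {x y} → x ∈ S → y ∈ S → id x ≡ id y → x ≡ y

mult-unique : ∀ {S o} → UniqueIds S → o ∈ S → mult S (key o) ≡ qty o
mult-unique {S} {o} U o∈ =
  DedupSum.dsum-unique _≟ₒ_ (λ x → key x ≟ₖ key o) qty o∈ refl λ y∈ e → U y∈ o∈ (cong proj₁ e)

mult-none : ∀ {S k} → (∀ {y} → y ∈ S → key y ≢ k) → mult S k ≡ 0
mult-none {S} {k} = DedupSum.dsum-none _≟ₒ_ (λ x → key x ≟ₖ k) qty

∈-remove⁻ : ∀ {o₀ S x} → x ∈ remove o₀ S → x ∈ S × x ≢ o₀
∈-remove⁻ {o₀} = ∈-filter⁻ (λ x → ¬? (x ≟ₒ o₀))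

∈-remove⁺ : ∀ {o₀ S x} → x ∈ S → x ≢ o₀ → x ∈ remove o₀ S
∈-remove⁺ {o₀} = ∈-filter⁺ (λ x → ¬? (x ≟ₒ o₀))

UniqueIds-⊆ : ∀ {S S₁} → (∀ {x} → x ∈ S₁ → x ∈ S) → UniqueIds S → UniqueIds S₁
UniqueIds-⊆ ⊆ U x∈ y∈ = U (⊆ x∈) (⊆ y∈)

UniqueIds-∷ : ∀ {x S} → (∀ {o} → o ∈ S → id o ≢ id x) → UniqueIds S → UniqueIds (x ∷ S)
UniqueIds-∷ fresh U (here refl) (here refl) _ = refl
UniqueIds-∷ fresh U (here refl) (there y∈) e = ⊥-elim (fresh y∈ (sym e))
UniqueIds-∷ fresh U (there x∈) (here refl) e = ⊥-elim (fresh x∈ e)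
UniqueIds-∷ fresh U (there x∈) (there y∈) e = U x∈ y∈ e

module _ (side : Transaction → ℕ) (pos : ∀ T i → i ∈ map side T → 0 < Qty side T i)
         (M : List Transaction) where

  fill : (o : Order) → id o ∈ map side M → Order
  fill o p = order (id o) (timestamp o) (Qty side M (id o)) (price o) (pos M (id o) p)

  Filled : List Order → List Order
  Filled [] = []
  Filled (o ∷ S) with id o ∈ℕ? map side M
  ... | yes p = fill o p ∷ Filled S
  ... | no _  = Filled S

  ∈-Filled⁺ : ∀ {S o} → o ∈ S → (p : id o ∈ map side M) → fill o p ∈ Filled S
  ∈-Filled⁺ {o ∷ S} o∈ p with id o ∈ℕ? map side M
  ∈-Filled⁺ (here refl) p | yes _ = here refl
  ∈-Filled⁺ (there o∈) p | yes _ = there (∈-Filled⁺ o∈ p)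
  ∈-Filled⁺ (here refl) p | no ¬p = ⊥-elim (¬p p)
  ∈-Filled⁺ (there o∈) p | no _ = ∈-Filled⁺ o∈ p

  ∈-Filled⁻ : ∀ {S x} → x ∈ Filled S → ∃[ o ] ∃[ p ] (o ∈ S × x ≡ fill o p)
  ∈-Filled⁻ {o ∷ S} x∈ with id o ∈ℕ? map side M
  ∈-Filled⁻ {o ∷ S} (here refl) | yes p = o , p , here refl , refl
  ∈-Filled⁻ (there x∈) | yes _ with ∈-Filled⁻ x∈
  ... | o , p , o∈ , e = o , p , there o∈ , e
  ∈-Filled⁻ x∈ | no _ with ∈-Filled⁻ x∈
  ... | o , p , o∈ , e = o , p , there o∈ , e

  UniqueIds-Filled : ∀ {S} → UniqueIds S → UniqueIds (Filled S)
  UniqueIds-Filled {S} U x∈ y∈ e with ∈-Filled⁻ {S} x∈ | ∈-Filled⁻ {S} y∈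
  ... | o , _ , o∈ , refl | o' , _ , o'∈ , refl with U o∈ o'∈ e
  ...   | refl = refl

  mult-Filled : ∀ {S o} → UniqueIds S → o ∈ S → mult (Filled S) (key o) ≡ Qty side M (id o)
  mult-Filled {S} {o} U o∈ with id o ∈ℕ? map side M
  ... | yes p = mult-unique (UniqueIds-Filled {S} U) (∈-Filled⁺ o∈ p)
  ... | no ¬p = trans (mult-none unfilled) (sym (Qty-none side untraded))
    where
    unfilled : ∀ {y} → y ∈ Filled S → key y ≢ key o
    unfilled y∈ e with ∈-Filled⁻ {S} y∈
    ... | o' , p , o'∈ , refl with U o'∈ o∈ (cong proj₁ e)
    ...   | refl = ¬p p
    untraded : ∀ {t} → t ∈ M → side t ≢ id o
    untraded t∈ e = ¬p (subst (_∈ map side M) e (∈-map⁺ side t∈))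

  mult-Filled-none : ∀ {S k} → (∀ {y} → y ∈ S → key y ≢ k) → mult (Filled S) k ≡ 0
  mult-Filled-none {S} outside = mult-none λ y∈ → case ∈-Filled⁻ {S} y∈ of λ where
    (o , p , o∈ , refl) → outside o∈

-- Conservation stated order by order: unlike _≡ₘ_-ₘ_ it composes along a
-- sequence of trades (residue-∷).
record IsResidue (side : Transaction → ℕ) (M : List Transaction) (S Ŝ : List Order) : Set where
  constructor residue
  field
    inside  : ∀ {o} → o ∈ S → mult Ŝ (key o) ≡ qty o ∸ Qty side M (id o)
    outside : ∀ k → (∀ {o} → o ∈ S → key o ≢ k) → mult Ŝ k ≡ 0

residue-[] : ∀ side {S} → UniqueIds S → IsResidue side [] S S
residue-[] _ U = residue (mult-unique U) λ _ → mult-none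

residue⇒≡ₘ : ∀ {side pos M S Ŝ} → UniqueIds S → IsResidue side M S Ŝ → Ŝ ≡ₘ S -ₘ Filled side pos M S
residue⇒≡ₘ {side} {pos} {M} {S} {Ŝ} U (residue inside outside) k with any? (λ o → key o ≟ₖ k) S
... | yes ∃o with find ∃o
...   | o , o∈ , refl =
  trans (inside o∈) (sym (cong₂ _∸_ (mult-unique U o∈) (mult-Filled side pos M U o∈)))
residue⇒≡ₘ {side} {pos} {M} {S} {Ŝ} U (residue inside outside) k | no ∄o = begin
  mult Ŝ k                                  ≡⟨ outside k ∉S ⟩
  0                                         ≡⟨ sym (cong₂ _∸_ (mult-none ∉S) (mult-Filled-none side pos M ∉S)) ⟩
  mult S k ∸ mult (Filled side pos M S) k   ∎
  where
  open ≡-Reasoning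
  ∉S : ∀ {o} → o ∈ S → key o ≢ k
  ∉S o∈ e = ∄o (lose o∈ e)

Bids≡Filled : ∀ M S → Bids M S ≡ Filled idBid occurs⇒QtyBid-pos M S
Bids≡Filled M [] = refl
Bids≡Filled M (b ∷ S) with id b ∈ℕ? idsBid M
... | yes _ = cong (_ ∷_) (Bids≡Filled M S)
... | no _  = Bids≡Filled M S

Asks≡Filled : ∀ M S → Asks M S ≡ Filled idAsk occurs⇒QtyAsk-pos M S
Asks≡Filled M [] = refl
Asks≡Filled M (a ∷ S) with id a ∈ℕ? idsAsk M
... | yes _ = cong (_ ∷_) (Asks≡Filled M S)
... | no _  = Asks≡Filled M S

reduce : (o : Order) {q : ℕ} → q < qty o → Order
reduce o {q} q<o = order (id o) (timestamp o) (qty o ∸ q) (price o) (m<n⇒0<n∸m q<o)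

TradesIn : (Transaction → ℕ) → List Transaction → List Order → Set
TradesIn side M S = ∀ {t} → t ∈ M → ∃[ o ] (o ∈ S × side t ≡ id o)

-- S₁ is what is left of S after q units of o₀ are traded: o₀ is used up and
-- gone, or it is replaced by its remainder.
record Fills (S : List Order) (o₀ : Order) (q : ℕ) (S₁ : List Order) : Set where
  field
    unique    : UniqueIds S₁
    untouched : ∀ {o} → o ∈ S → o ≢ o₀ → o ∈ S₁
    from      : ∀ {o} → o ∈ S₁ → ∃[ o' ] (o' ∈ S × key o ≡ key o')
    remainder : (q ≡ qty o₀ × (∀ {o} → o ∈ S₁ → id o ≢ id o₀)) ⊎
                (∃[ o₁ ] (o₁ ∈ S₁ × key o₁ ≡ key o₀ × qty o₁ ≡ qty o₀ ∸ q))

module _ (side : Transaction → ℕ) {S S₁ : List Order} {o₀ : Order} {t : Transaction} {M : List Transaction}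
         (U : UniqueIds S) (o₀∈ : o₀ ∈ S) (t↦o₀ : side t ≡ id o₀) (t∉M : t ∉ M)
         (fills : Fills S o₀ (tqty t) S₁) where
  open Fills fills

  private
    untraded-by-t : ∀ {o} → o ∈ S → o ≢ o₀ → side t ≢ id o
    untraded-by-t o∈ o≢o₀ e = o≢o₀ (U o∈ o₀∈ (trans (sym e) t↦o₀))

    Qty-∷-o₀ : Qty side (t ∷ M) (id o₀) ≡ tqty t + Qty side M (id o₀)
    Qty-∷-o₀ = Qty-∷-hit side t∉M t↦o₀

  residue-∷ : ∀ {Ŝ} → IsResidue side M S₁ Ŝ → IsResidue side (t ∷ M) S Ŝ
  residue-∷ {Ŝ} (residue inside outside) = residue inside′ outside′
    where
    open ≡-Reasoning
    inside′ : ∀ {o} → o ∈ S → mult Ŝ (key o) ≡ qty o ∸ Qty side (t ∷ M) (id o)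
    inside′ {o} o∈ with o ≟ₒ o₀ | remainder
    ... | no o≢o₀ | _ = trans (inside (untouched o∈ o≢o₀))
                              (cong (qty o ∸_) (sym (Qty-∷-miss side t∉M (untraded-by-t o∈ o≢o₀))))
    ... | yes refl | inj₁ (filled , gone) = begin
      mult Ŝ (key o₀)                          ≡⟨ outside (key o₀) (λ o∈₁ e → gone o∈₁ (cong proj₁ e)) ⟩
      0                                        ≡⟨ sym (m≤n⇒m∸n≡0 (m≤m+n (qty o₀) _)) ⟩
      qty o₀ ∸ (qty o₀ + Qty side M (id o₀))   ≡⟨ cong (λ q → qty o₀ ∸ (q + Qty side M (id o₀))) (sym filled) ⟩
      qty o₀ ∸ (tqty t + Qty side M (id o₀))   ≡⟨ cong (qty o₀ ∸_) (sym Qty-∷-o₀) ⟩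
      qty o₀ ∸ Qty side (t ∷ M) (id o₀)        ∎
    ... | yes refl | inj₂ (o₁ , o₁∈ , refl , o₁-qty) = begin
      mult Ŝ (key o₁)                          ≡⟨ inside o₁∈ ⟩
      qty o₁ ∸ Qty side M (id o₁)              ≡⟨ cong (_∸ Qty side M (id o₁)) o₁-qty ⟩
      (qty o₀ ∸ tqty t) ∸ Qty side M (id o₀)   ≡⟨ ∸-+-assoc (qty o₀) (tqty t) _ ⟩
      qty o₀ ∸ (tqty t + Qty side M (id o₀))   ≡⟨ cong (qty o₀ ∸_) (sym Qty-∷-o₀) ⟩
      qty o₀ ∸ Qty side (t ∷ M) (id o₀)        ∎
    outside′ : ∀ k → (∀ {o} → o ∈ S → key o ≢ k) → mult Ŝ k ≡ 0
    outside′ k ∉S = outside k λ o∈₁ e → case from o∈₁ of λ where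
      (o' , o'∈ , e') → ∉S o'∈ (trans (sym e') e)

  within-∷ : tqty t ≤ qty o₀ → TradesIn side M S₁ → (∀ {o} → o ∈ S₁ → Qty side M (id o) ≤ qty o) →
             ∀ {o} → o ∈ S → Qty side (t ∷ M) (id o) ≤ qty o
  within-∷ t≤o₀ trades within {o} o∈ with o ≟ₒ o₀ | remainder
  ... | no o≢o₀ | _ = ≤-trans (≤-reflexive (Qty-∷-miss side t∉M (untraded-by-t o∈ o≢o₀)))
                              (within (untouched o∈ o≢o₀))
  ... | yes refl | inj₁ (filled , gone) = begin
    Qty side (t ∷ M) (id o₀)        ≡⟨ Qty-∷-o₀ ⟩
    tqty t + Qty side M (id o₀)     ≡⟨ cong₂ _+_ filled (Qty-none side untraded) ⟩
    qty o₀ + 0                      ≡⟨ +-identityʳ (qty o₀) ⟩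
    qty o₀                          ∎
    where
    open ≤-Reasoning
    untraded : ∀ {t'} → t' ∈ M → side t' ≢ id o₀
    untraded t'∈ e = case trades t'∈ of λ where
      (o₁ , o₁∈ , e') → gone o₁∈ (trans (sym e') e)
  ... | yes refl | inj₂ (o₁ , o₁∈ , o₁-key , o₁-qty) = begin
    Qty side (t ∷ M) (id o₀)        ≡⟨ Qty-∷-o₀ ⟩
    tqty t + Qty side M (id o₀)     ≡⟨ cong (λ i → tqty t + Qty side M i) (cong proj₁ (sym o₁-key)) ⟩
    tqty t + Qty side M (id o₁)     ≤⟨ +-monoʳ-≤ (tqty t) (within o₁∈) ⟩
    tqty t + qty o₁                 ≡⟨ cong (tqty t +_) o₁-qty ⟩
    tqty t + (qty o₀ ∸ tqty t)      ≡⟨ m+[n∸m]≡n t≤o₀ ⟩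
    qty o₀                          ∎
    where open ≤-Reasoning

module _ {S o₀} (U : UniqueIds S) (o₀∈ : o₀ ∈ S) where

  remove-fresh : ∀ {x} → x ∈ remove o₀ S → id x ≢ id o₀
  remove-fresh x∈ e = let (x∈S , x≢o₀) = ∈-remove⁻ x∈ in x≢o₀ (U x∈S o₀∈ e)

  UniqueIds-remove : UniqueIds (remove o₀ S)
  UniqueIds-remove = UniqueIds-⊆ (proj₁ ∘ ∈-remove⁻) U

  remove-fills : Fills S o₀ (qty o₀) (remove o₀ S)
  remove-fills = record
    { unique = UniqueIds-remove
    ; untouched = ∈-remove⁺
    ; from = λ x∈ → _ , proj₁ (∈-remove⁻ x∈) , refl
    ; remainder = inj₁ (refl , remove-fresh)
    }

  reduce-fills : ∀ {q} (q<o₀ : q < qty o₀) → Fills S o₀ q (reduce o₀ q<o₀ ∷ remove o₀ S)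
  reduce-fills q<o₀ = record
    { unique = UniqueIds-∷ remove-fresh UniqueIds-remove
    ; untouched = λ o∈ o≢o₀ → there (∈-remove⁺ o∈ o≢o₀)
    ; from = λ { (here refl) → o₀ , o₀∈ , refl ; (there x∈) → _ , proj₁ (∈-remove⁻ x∈) , refl }
    ; remainder = inj₂ (_ , here refl , refl , refl)
    }

module _ {S o₀} (fresh : ∀ {o} → o ∈ S → id o ≢ id o₀) (U : UniqueIds S) where

  tail-fills : Fills (o₀ ∷ S) o₀ (qty o₀) S
  tail-fills = record
    { unique = U
    ; untouched = λ { (here refl) o≢o₀ → ⊥-elim (o≢o₀ refl) ; (there o∈) _ → o∈ }
    ; from = λ o∈ → _ , there o∈ , refl
    ; remainder = inj₁ (refl , fresh)
    }

  reduce-head-fills : ∀ {q} (q<o₀ : q < qty o₀) → Fills (o₀ ∷ S) o₀ q (reduce o₀ q<o₀ ∷ S)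
  reduce-head-fills q<o₀ = record
    { unique = UniqueIds-∷ fresh U
    ; untouched = λ { (here refl) o≢o₀ → ⊥-elim (o≢o₀ refl) ; (there o∈) _ → there o∈ }
    ; from = λ { (here refl) → o₀ , here refl , refl ; (there o∈) → _ , there o∈ , refl }
    ; remainder = inj₂ (_ , here refl , refl , refl)
    }

module Best {A : Set} {_≈_ _≻_ : Rel A 0ℓ} (sto : IsStrictTotalOrder _≈_ _≻_) (_≻?_ : Decidable₂ _≻_) where
  open IsStrictTotalOrder sto using (compare; irrefl; asym; <-respˡ-≈; module Eq) renaming (trans to ≻-trans)

  best : A → List A → A
  best c [] = c
  best c (x ∷ xs) with x ≻? c
  ... | yes _ = best x xs
  ... | no _  = best c xs

  best-∈ : ∀ c xs → best c xs ∈ c ∷ xs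
  best-∈ c [] = here refl
  best-∈ c (x ∷ xs) with x ≻? c
  ... | yes _ = there (best-∈ x xs)
  ... | no _ with best-∈ c xs
  ...   | here e = here e
  ...   | there b∈ = there (there b∈)

  ⊁-trans : ∀ {x y z} → ¬ x ≻ y → ¬ y ≻ z → ¬ x ≻ z
  ⊁-trans {x} {y} x⊁y y⊁z x≻z with compare x y
  ... | tri< x≻y _ _ = x⊁y x≻y
  ... | tri≈ _ x≈y _ = y⊁z (<-respˡ-≈ x≈y x≻z)
  ... | tri> _ _ y≻x = y⊁z (≻-trans y≻x x≻z)

  best-maximal : ∀ c xs {y} → y ∈ c ∷ xs → ¬ y ≻ best c xs
  best-maximal c [] (here refl) = irrefl Eq.refl
  best-maximal c (x ∷ xs) y∈ with x ≻? c
  best-maximal c (x ∷ xs) (here refl) | yes x≻c = ⊁-trans (asym x≻c) (best-maximal x xs (here refl))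
  best-maximal c (x ∷ xs) (there y∈)  | yes _   = best-maximal x xs y∈
  best-maximal c (x ∷ xs) (here refl) | no _    = best-maximal c xs (here refl)
  best-maximal c (x ∷ xs) (there (here refl)) | no x⊁c = ⊁-trans x⊁c (best-maximal c xs (here refl))
  best-maximal c (x ∷ xs) (there (there y∈))  | no _   = best-maximal c xs (there y∈)

priceTime : Order → ℕ × ℕ
priceTime o = price o , timestamp o

≻ᵇ-isStrictTotalOrder : IsStrictTotalOrder (Pointwise _≡_ _≡_ on priceTime) _≻ᵇ_
≻ᵇ-isStrictTotalOrder = On.isStrictTotalOrder priceTime
  (×-isStrictTotalOrder (Flip.isStrictTotalOrder <-isStrictTotalOrder) <-isStrictTotalOrder)

≻ᵃ-isStrictTotalOrder : IsStrictTotalOrder (Pointwise _≡_ _≡_ on priceTime) _≻ᵃ_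
≻ᵃ-isStrictTotalOrder = On.isStrictTotalOrder priceTime
  (×-isStrictTotalOrder <-isStrictTotalOrder <-isStrictTotalOrder)

module BestBid = Best ≻ᵇ-isStrictTotalOrder _≻ᵇ?_
module BestAsk = Best ≻ᵃ-isStrictTotalOrder _≻ᵃ?_

bestBid≗best : ∀ c xs → bestBid c xs ≡ BestBid.best c xs
bestBid≗best c [] = refl
bestBid≗best c (x ∷ xs) with x ≻ᵇ? c
... | yes _ = bestBid≗best x xs
... | no _  = bestBid≗best c xs

bestAsk≗best : ∀ c xs → bestAsk c xs ≡ BestAsk.best c xs
bestAsk≗best c [] = refl
bestAsk≗best c (x ∷ xs) with x ≻ᵃ? c
... | yes _ = bestAsk≗best x xs
... | no _  = bestAsk≗best c xs

bestBid-∈ : ∀ c xs → bestBid c xs ∈ c ∷ xs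
bestBid-∈ c xs rewrite bestBid≗best c xs = BestBid.best-∈ c xs

bestAsk-∈ : ∀ c xs → bestAsk c xs ∈ c ∷ xs
bestAsk-∈ c xs rewrite bestAsk≗best c xs = BestAsk.best-∈ c xs

bestBid-maximal : ∀ c xs {y} → y ∈ c ∷ xs → ¬ y ≻ᵇ bestBid c xs
bestBid-maximal c xs rewrite bestBid≗best c xs = BestBid.best-maximal c xs

bestAsk-maximal : ∀ c xs {y} → y ∈ c ∷ xs → ¬ y ≻ᵃ bestAsk c xs
bestAsk-maximal c xs rewrite bestAsk≗best c xs = BestAsk.best-maximal c xs

≻ᵇ-irrefl : ∀ {b} → ¬ b ≻ᵇ b
≻ᵇ-irrefl {b} = IsStrictTotalOrder.irrefl ≻ᵇ-isStrictTotalOrder {b} {b} (refl , refl)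

≻ᵃ-irrefl : ∀ {a} → ¬ a ≻ᵃ a
≻ᵃ-irrefl {a} = IsStrictTotalOrder.irrefl ≻ᵃ-isStrictTotalOrder {a} {a} (refl , refl)

≻ᵇ⇒≥ : ∀ {b β} → b ≻ᵇ β → price β ≤ price b
≻ᵇ⇒≥ (inj₁ β<b) = <⇒≤ β<b
≻ᵇ⇒≥ (inj₂ (b≡β , _)) = ≤-reflexive (sym b≡β)

≻ᵃ⇒≤ : ∀ {a α} → a ≻ᵃ α → price a ≤ price α
≻ᵃ⇒≤ (inj₁ a<α) = <⇒≤ a<α
≻ᵃ⇒≤ (inj₂ (a≡α , _)) = ≤-reflexive a≡α

⊁ᵇ⇒≤ : ∀ {b β} → ¬ b ≻ᵇ β → price b ≤ price β
⊁ᵇ⇒≤ b⊁β = ≮⇒≥ (b⊁β ∘ inj₁)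

⊁ᵃ⇒≥ : ∀ {a α} → ¬ a ≻ᵃ α → price α ≤ price a
⊁ᵃ⇒≥ a⊁α = ≮⇒≥ (a⊁α ∘ inj₁)

trade : ℕ × ℕ → (q : ℕ) → .(0 < q) → Transaction
trade (i , j) q q>0 = transaction i j q q>0

-- The data shared by Match_Ask (resting bids, incoming ask) and Match_Bid
-- (resting asks, incoming bid): price r ⊒ price ι says that a resting order r
-- and an incoming order ι are tradable, ≻ compares resting orders and ≻ᵢ
-- orders of the incoming side.
record Side : Set₁ where
  field
    restId incId : Transaction → ℕ
    dealIds      : (r ι : Order) → ℕ × ℕ
    restId-deal  : ∀ r ι q .{q>0} → restId (trade (dealIds r ι) q q>0) ≡ id r
    incId-deal   : ∀ r ι q .{q>0} → incId (trade (dealIds r ι) q q>0) ≡ id ι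
    _⊒_          : ℕ → ℕ → Set
    _⊒?_         : Decidable₂ _⊒_
    _≻_          : Order → Order → Set
    best         : Order → List Order → Order
    best-∈       : ∀ c xs → best c xs ∈ c ∷ xs
    best-maximal : ∀ c xs {y} → y ∈ c ∷ xs → ¬ y ≻ best c xs
    ⊒-unbeaten   : ∀ {r r₀ p} → ¬ r ≻ r₀ → price r ⊒ p → price r₀ ⊒ p
    _≻ᵢ_         : Order → Order → Set
    ≻ᵢ-irrefl    : ∀ {o} → ¬ o ≻ᵢ o
    ⊒-≻ᵢ         : ∀ {o ι p} → o ≻ᵢ ι → p ⊒ price ι → p ⊒ price o

module Matching (S : Side) where
  open Side S

  deal : (r ι : Order) (q : ℕ) → .(0 < q) → Transaction
  deal r ι q q>0 = trade (dealIds r ι) q q>0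

  match : ℕ → List Order → List Order → Order → Result
  match zero R O ι = R , ι ∷ O , []
  match (suc n) [] O ι = [] , ι ∷ O , []
  match (suc n) R@(r ∷ rs) O ι@(order _ _ _ _ ι>0) with best r rs
  ... | β@(order _ _ _ _ β>0) with price β ⊒? price ι
  ...   | no _ = R , ι ∷ O , []
  ...   | yes _ with <-cmp (qty β) (qty ι)
  ...     | tri≈ _ _ _ = remove β R , O , [ deal β ι (qty ι) ι>0 ]
  ...     | tri> _ _ ι<β = reduce β ι<β ∷ remove β R , O , [ deal β ι (qty ι) ι>0 ]
  ...     | tri< β<ι _ _ =
              let (R'' , O'' , M'') = match n (remove β R) O (reduce ι β<ι)
              in R'' , O'' , deal β ι (qty β) β>0 ∷ M''

  Crossing : List Order → List Order → Set
  Crossing R O = ∃[ r ] ∃[ o ] (r ∈ R × o ∈ O × price r ⊒ price o)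

  ValidFor : Transaction → List Order → List Order → Set
  ValidFor t R O = ∃[ r ] ∃[ o ] (r ∈ R × o ∈ O × restId t ≡ id r × incId t ≡ id o ×
                                  price r ⊒ price o × tqty t ≤ qty r ⊓ qty o)

  record Legal (R O : List Order) (ι : Order) : Set where
    field
      unique-rest : UniqueIds R
      unique-inc  : UniqueIds (ι ∷ O)
      uncrossed   : ¬ Crossing R O

  record Correct (R O : List Order) (ι : Order) (R̂ Ô : List Order) (M : List Transaction) : Set where
    field
      valid        : ∀ {t} → t ∈ M → ValidFor t R (ι ∷ O)
      within-rest  : ∀ {r} → r ∈ R → Qty restId M (id r) ≤ qty r
      within-inc   : ∀ {o} → o ∈ ι ∷ O → Qty incId M (id o) ≤ qty o
      residue-rest : IsResidue restId M R R̂
      residue-inc  : IsResidue incId M (ι ∷ O) Ô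
      priority     : ∀ {r r'} → r ∈ R → r' ∈ R → r ≻ r' → id r' ∈ map restId M → Qty restId M (id r) ≡ qty r
      uncrossed    : ¬ Crossing R̂ Ô

    trades-rest : TradesIn restId M R
    trades-rest t∈ = let (r , _ , r∈ , _ , t↦r , _) = valid t∈ in r , r∈ , t↦r

    trades-inc : TradesIn incId M (ι ∷ O)
    trades-inc t∈ = let (_ , o , _ , o∈ , _ , t↦o , _) = valid t∈ in o , o∈ , t↦o

  no-trade : ∀ {R O ι} → Legal R O ι → ¬ Crossing R (ι ∷ O) → Correct R O ι R (ι ∷ O) []
  no-trade legal uncrossed = record
    { valid = λ ()
    ; within-rest = λ _ → z≤n
    ; within-inc = λ _ → z≤n
    ; residue-rest = residue-[] restId (Legal.unique-rest legal)
    ; residue-inc = residue-[] incId (Legal.unique-inc legal)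
    ; priority = λ _ _ _ ()
    ; uncrossed = uncrossed
    }

  best-misses : ∀ {R O ι β} → (∀ {y} → y ∈ R → ¬ y ≻ β) → ¬ price β ⊒ price ι →
                ¬ Crossing R O → ¬ Crossing R (ι ∷ O)
  best-misses {β = β} β-best β⋣ι uncrossed (r , _ , r∈ , here refl , r⊒ι) =
    β⋣ι (⊒-unbeaten {r} {β} (β-best r∈) r⊒ι)
  best-misses β-best β⋣ι uncrossed (r , o , r∈ , there o∈ , r⊒o) = uncrossed (r , o , r∈ , o∈ , r⊒o)

  module Step {R O ι β} (β∈ : β ∈ R) (β-best : ∀ {y} → y ∈ R → ¬ y ≻ β) (β⊒ι : price β ⊒ price ι)
              (legal : Legal R O ι) where
    open Legal legal

    R₁ : List Order
    R₁ = remove β R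

    ι-fresh : ∀ {o} → o ∈ O → id o ≢ id ι
    ι-fresh o∈ e with unique-inc (there o∈) (here refl) e
    ... | refl = uncrossed (β , _ , β∈ , o∈ , β⊒ι)

    unique-O : UniqueIds O
    unique-O = UniqueIds-⊆ there unique-inc

    uncrossed₁ : ¬ Crossing R₁ O
    uncrossed₁ (r , o , r∈ , o∈ , r⊒o) = uncrossed (r , o , proj₁ (∈-remove⁻ r∈) , o∈ , r⊒o)

    shorter : length R₁ < length R
    shorter = filter-notAll (λ x → ¬? (x ≟ₒ β)) R (Any.map (λ β≡x x≢β → x≢β (sym β≡x)) β∈)

    legal₁ : (β<ι : qty β < qty ι) → Legal R₁ O (reduce ι β<ι)
    legal₁ β<ι = record
      { unique-rest = UniqueIds-remove unique-rest β∈
      ; unique-inc = UniqueIds-∷ ι-fresh unique-O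
      ; uncrossed = uncrossed₁
      }

    module Trade (q : ℕ) .(q>0 : 0 < q) (q≤β : q ≤ qty β) (q≤ι : q ≤ qty ι) where

      t : Transaction
      t = deal β ι q q>0

      t↦β : restId t ≡ id β
      t↦β = restId-deal β ι q

      t↦ι : incId t ≡ id ι
      t↦ι = incId-deal β ι q

      t-valid : ValidFor t R (ι ∷ O)
      t-valid = β , ι , β∈ , here refl , t↦β , t↦ι , β⊒ι , ⊓-glb q≤β q≤ι

      t-respects-priority : ∀ {r r'} → r ∈ R → r' ∈ R → r ≻ r' → restId t ≢ id r'
      t-respects-priority r∈ r'∈ r≻r' e with unique-rest r'∈ β∈ (trans (sym e) t↦β)
      ... | refl = β-best r∈ r≻r'

    single-trade : ∀ .{ι>0} {R̂} → qty ι ≤ qty β → Fills R β (qty ι) R̂ → ¬ Crossing R̂ O →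
                   Correct R O ι R̂ O [ deal β ι (qty ι) ι>0 ]
    single-trade {ι>0} ι≤β fills uncrossed-R̂ = record
      { valid = λ { (here refl) → t-valid }
      ; within-rest = within-∷ restId {M = []} unique-rest β∈ t↦β (λ ()) fills ι≤β (λ ()) (λ _ → z≤n)
      ; within-inc = within-∷ incId {M = []} unique-inc (here refl) t↦ι (λ ()) ι-filled ≤-refl (λ ()) (λ _ → z≤n)
      ; residue-rest = residue-∷ restId {M = []} unique-rest β∈ t↦β (λ ()) fills
                         (residue-[] restId (Fills.unique fills))
      ; residue-inc = residue-∷ incId {M = []} unique-inc (here refl) t↦ι (λ ()) ι-filled
                         (residue-[] incId unique-O)
      ; priority = λ { r∈ r'∈ r≻r' (here e) → ⊥-elim (t-respects-priority r∈ r'∈ r≻r' (sym e)) }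
      ; uncrossed = uncrossed-R̂
      }
      where
      open Trade (qty ι) ι>0 ι≤β ≤-refl
      ι-filled : Fills (ι ∷ O) ι (qty ι) O
      ι-filled = tail-fills ι-fresh unique-O

    exact : ∀ .{ι>0} → qty β ≡ qty ι → Correct R O ι R₁ O [ deal β ι (qty ι) ι>0 ]
    exact β≡ι = single-trade (≤-reflexive (sym β≡ι))
                  (subst (λ q → Fills R β q R₁) β≡ι (remove-fills unique-rest β∈)) uncrossed₁

    partial-rest : ∀ .{ι>0} (ι<β : qty ι < qty β) →
                   Correct R O ι (reduce β ι<β ∷ R₁) O [ deal β ι (qty ι) ι>0 ]
    partial-rest ι<β = single-trade (<⇒≤ ι<β) (reduce-fills unique-rest β∈ ι<β) uncrossed-reduced
      where
      uncrossed-reduced : ¬ Crossing (reduce β ι<β ∷ R₁) O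
      uncrossed-reduced (_ , o , here refl , o∈ , β⊒o) = uncrossed (β , o , β∈ , o∈ , β⊒o)
      uncrossed-reduced (r , o , there r∈ , o∈ , r⊒o) = uncrossed₁ (r , o , r∈ , o∈ , r⊒o)

    module Exhaust .(β>0 : 0 < qty β) (β≤ι : qty β ≤ qty ι) {M} (trades : TradesIn restId M R₁) where
      open Trade (qty β) β>0 ≤-refl β≤ι public

      β-untraded : ∀ {t'} → t' ∈ M → restId t' ≢ id β
      β-untraded t'∈ e = let (r , r∈ , e') = trades t'∈ in remove-fresh unique-rest β∈ r∈ (trans (sym e') e)

      t∉M : t ∉ M
      t∉M t∈ = β-untraded t∈ t↦β

      β-exhausted : Qty restId (t ∷ M) (id β) ≡ qty β
      β-exhausted = begin
        Qty restId (t ∷ M) (id β)        ≡⟨ Qty-∷-hit restId t∉M t↦β ⟩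
        qty β + Qty restId M (id β)      ≡⟨ cong (qty β +_) (Qty-none restId β-untraded) ⟩
        qty β + 0                        ≡⟨ +-identityʳ (qty β) ⟩
        qty β                            ∎
        where open ≡-Reasoning

      priority-∷ : (∀ {r r'} → r ∈ R₁ → r' ∈ R₁ → r ≻ r' → id r' ∈ map restId M → Qty restId M (id r) ≡ qty r) →
                   ∀ {r r'} → r ∈ R → r' ∈ R → r ≻ r' → id r' ∈ map restId (t ∷ M) →
                   Qty restId (t ∷ M) (id r) ≡ qty r
      priority-∷ _ r∈ r'∈ r≻r' (here e) = ⊥-elim (t-respects-priority r∈ r'∈ r≻r' (sym e))
      priority-∷ priority {r} r∈ r'∈ r≻r' (there r'∈M) with ∈-map⁻ restId r'∈M
      ... | t' , t'∈ , e with trades t'∈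
      ...   | x , x∈ , e' with unique-rest r'∈ (proj₁ (∈-remove⁻ x∈)) (trans e e')
      ...     | refl with r ≟ₒ β
      ...       | yes refl = β-exhausted
      ...       | no r≢β = trans (Qty-∷-miss restId t∉M λ e″ → r≢β (unique-rest r∈ β∈ (trans (sym e″) t↦β)))
                                 (priority (∈-remove⁺ r∈ r≢β) x∈ r≻r' r'∈M)

    partial-inc : ∀ .{β>0} (β<ι : qty β < qty ι) {R̂ Ô M} → Correct R₁ O (reduce ι β<ι) R̂ Ô M →
                  Correct R O ι R̂ Ô (deal β ι (qty β) β>0 ∷ M)
    partial-inc {β>0} β<ι C = record
      { valid = λ { (here refl) → t-valid ; (there t'∈) → lift (C.valid t'∈) }
      ; within-rest = within-∷ restId unique-rest β∈ t↦β t∉M β-filled ≤-refl C.trades-rest C.within-rest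
      ; within-inc = within-∷ incId unique-inc (here refl) t↦ι t∉M ι-reduced (<⇒≤ β<ι) C.trades-inc C.within-inc
      ; residue-rest = residue-∷ restId unique-rest β∈ t↦β t∉M β-filled C.residue-rest
      ; residue-inc = residue-∷ incId unique-inc (here refl) t↦ι t∉M ι-reduced C.residue-inc
      ; priority = priority-∷ C.priority
      ; uncrossed = C.uncrossed
      }
      where
      module C = Correct C
      open Exhaust β>0 (<⇒≤ β<ι) C.trades-rest

      β-filled : Fills R β (qty β) R₁
      β-filled = remove-fills unique-rest β∈

      ι-reduced : Fills (ι ∷ O) ι (qty β) (reduce ι β<ι ∷ O)
      ι-reduced = reduce-head-fills ι-fresh unique-O β<ι

      lift : ∀ {t'} → ValidFor t' R₁ (reduce ι β<ι ∷ O) → ValidFor t' R (ι ∷ O)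
      lift (r , _ , r∈ , here refl , t↦r , t↦ι' , r⊒ι , bound) =
        r , ι , proj₁ (∈-remove⁻ r∈) , here refl , t↦r , t↦ι' , r⊒ι ,
        ≤-trans bound (⊓-monoʳ-≤ (qty r) (m∸n≤m (qty ι) (qty β)))
      lift (r , o , r∈ , there o∈ , rest) = r , o , proj₁ (∈-remove⁻ r∈) , there o∈ , rest

  match-correct : ∀ n R O ι → length R ≤ n → Legal R O ι →
                  let (R̂ , Ô , M) = match n R O ι in Correct R O ι R̂ Ô M
  match-correct zero [] O ι _ legal = no-trade legal λ ()
  match-correct (suc n) [] O ι _ legal = no-trade legal λ ()
  match-correct (suc n) (r ∷ rs) O ι@(order _ _ _ _ _) len legal
    with best r rs | best-∈ r rs | best-maximal r rs
  ... | β@(order _ _ _ _ _) | β∈ | β-best with price β ⊒? price ι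
  ...   | no β⋣ι = no-trade legal (best-misses β-best β⋣ι (Legal.uncrossed legal))
  ...   | yes β⊒ι with <-cmp (qty β) (qty ι)
  ...     | tri≈ _ β≡ι _ = Step.exact β∈ β-best β⊒ι legal β≡ι
  ...     | tri> _ _ ι<β = Step.partial-rest β∈ β-best β⊒ι legal ι<β
  ...     | tri< β<ι _ _ = Step.partial-inc β∈ β-best β⊒ι legal β<ι
                             (match-correct n _ O _ (≤-pred (≤-trans (Step.shorter β∈ β-best β⊒ι legal) len))
                                (Step.legal₁ β∈ β-best β⊒ι legal β<ι))

  -- An order beating a traded incoming order on its own side would have
  -- crossed the book already, so the premise is contradictory.
  incoming-priority : ∀ {R O ι R̂ Ô M} → Legal R O ι → Correct R O ι R̂ Ô M →
                      ∀ {o o'} → o ∈ ι ∷ O → o' ∈ ι ∷ O → o ≻ᵢ o' → id o' ∈ map incId M →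
                      Qty incId M (id o) ≡ qty o
  incoming-priority legal C o∈ o'∈ o≻o' o'∈M with ∈-map⁻ incId o'∈M
  ... | t , t∈ , e with Correct.valid C t∈
  ... | r , o₀ , r∈ , o₀∈ , _ , t↦o₀ , r⊒o₀ , _ with Legal.unique-inc legal o'∈ o₀∈ (trans e t↦o₀)
  ... | refl with o₀∈ | o∈
  ... | there o₀∈O | _ = ⊥-elim (Legal.uncrossed legal (r , o₀ , r∈ , o₀∈O , r⊒o₀))
  ... | here refl | here refl = ⊥-elim (≻ᵢ-irrefl o≻o')
  ... | here refl | there o∈O = ⊥-elim (Legal.uncrossed legal (r , _ , r∈ , o∈O , ⊒-≻ᵢ o≻o' r⊒o₀))

askSide : Side
askSide = record
  { restId = idBid ; incId = idAsk
  ; dealIds = λ b a → id b , id a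
  ; restId-deal = λ _ _ _ → refl ; incId-deal = λ _ _ _ → refl
  ; _⊒_ = λ pb pa → pa ≤ pb ; _⊒?_ = λ pb pa → pa ≤? pb
  ; _≻_ = _≻ᵇ_ ; best = bestBid
  ; best-∈ = bestBid-∈ ; best-maximal = bestBid-maximal
  ; ⊒-unbeaten = λ {b} {β} b⊁β pa≤b → ≤-trans pa≤b (⊁ᵇ⇒≤ {b} {β} b⊁β)
  ; _≻ᵢ_ = _≻ᵃ_ ; ≻ᵢ-irrefl = λ {a} → ≻ᵃ-irrefl {a}
  ; ⊒-≻ᵢ = λ {a} {α} a≻α α≤b → ≤-trans (≻ᵃ⇒≤ {a} {α} a≻α) α≤b
  }

bidSide : Side
bidSide = record
  { restId = idAsk ; incId = idBid
  ; dealIds = λ a b → id b , id a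
  ; restId-deal = λ _ _ _ → refl ; incId-deal = λ _ _ _ → refl
  ; _⊒_ = _≤_ ; _⊒?_ = _≤?_
  ; _≻_ = _≻ᵃ_ ; best = bestAsk
  ; best-∈ = bestAsk-∈ ; best-maximal = bestAsk-maximal
  ; ⊒-unbeaten = λ {a} {α} a⊁α a≤pb → ≤-trans (⊁ᵃ⇒≥ {a} {α} a⊁α) a≤pb
  ; _≻ᵢ_ = _≻ᵇ_ ; ≻ᵢ-irrefl = λ {b} → ≻ᵇ-irrefl {b}
  ; ⊒-≻ᵢ = λ {b} {β} b≻β a≤β → ≤-trans a≤β (≻ᵇ⇒≥ {b} {β} b≻β)
  }

open Matching using (match; match-correct; Legal; Correct; incoming-priority)

matchAsk≡match : ∀ n B A α → matchAsk n B A α ≡ match askSide n B A α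
matchAsk≡match zero B A α = refl
matchAsk≡match (suc n) [] A α = refl
matchAsk≡match (suc n) (b ∷ bs) A α with bestBid b bs
... | β@(order _ _ _ _ β>0) with price α ≤? price β
...   | no _ = refl
...   | yes _ with <-cmp (qty β) (qty α)
...     | tri≈ _ _ _ = refl
...     | tri> _ _ _ = refl
...     | tri< β<α _ _ = cong (λ (B'' , A'' , M'') → B'' , A'' , transaction (id β) (id α) (qty β) β>0 ∷ M'')
                              (matchAsk≡match n (remove β (b ∷ bs)) A (reduce α β<α))

swap : Result → Result
swap (X , Y , M) = Y , X , M

matchBid≡match : ∀ n B A β → matchBid n B A β ≡ swap (match bidSide n A B β)
matchBid≡match zero B A β = refl
matchBid≡match (suc n) B [] β = refl
matchBid≡match (suc n) B (a ∷ as) β with bestAsk a as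
... | α@(order _ _ _ _ α>0) with price α ≤? price β
...   | no _ = refl
...   | yes _ with <-cmp (qty α) (qty β)
...     | tri≈ _ _ _ = refl
...     | tri> _ _ _ = refl
...     | tri< α<β _ _ = cong (λ (B'' , A'' , M'') → B'' , A'' , transaction (id β) (id α) (qty α) α>0 ∷ M'')
                              (matchBid≡match n B (remove α (a ∷ as)) (reduce β α<β))

Admissible⇒UniqueIds : ∀ {B A} → Admissible B A → UniqueIds (B ++ A)
Admissible⇒UniqueIds adm {x} {y} x∈ y∈ e with x ≟ₒ y
... | yes x≡y = x≡y
... | no x≢y = ⊥-elim (proj₁ (adm x∈ y∈ x≢y) e)

Admissible⇒UniqueIdsˡ : ∀ B {A} → Admissible B A → UniqueIds B
Admissible⇒UniqueIdsˡ B adm = UniqueIds-⊆ ∈-++⁺ˡ (Admissible⇒UniqueIds {B} adm)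

Admissible⇒UniqueIdsʳ : ∀ B {A} → Admissible B A → UniqueIds A
Admissible⇒UniqueIdsʳ B adm = UniqueIds-⊆ (∈-++⁺ʳ B) (Admissible⇒UniqueIds {B} adm)

sell-legal : ∀ {B A α} → LegalInput B A (Sell α) → Legal askSide B A α
sell-legal {B} (¬match , adm) = record
  { unique-rest = Admissible⇒UniqueIdsˡ B adm
  ; unique-inc = Admissible⇒UniqueIdsʳ B adm
  ; uncrossed = ¬match
  }

buy-legal : ∀ {B A β} → LegalInput B A (Buy β) → Legal bidSide A B β
buy-legal {B} {β = β} (¬match , adm) = record
  { unique-rest = Admissible⇒UniqueIdsʳ (β ∷ B) adm
  ; unique-inc = Admissible⇒UniqueIdsˡ (β ∷ B) adm
  ; uncrossed = λ (a , b , a∈ , b∈ , a≤b) → ¬match (b , a , b∈ , a∈ , a≤b)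
  }

sell-correct : ∀ {B A α} → LegalInput B A (Sell α) →
               let (B̂ , Â , M) = Match-Ask B A α in Correct askSide B A α B̂ Â M
sell-correct {B} {A} {α} li rewrite matchAsk≡match (length B) B A α =
  match-correct askSide (length B) B A α ≤-refl (sell-legal li)

buy-correct : ∀ {B A β} → LegalInput B A (Buy β) →
              let (B̂ , Â , M) = Match-Bid B A β in Correct bidSide A B β Â B̂ M
buy-correct {B} {A} {β} li rewrite matchBid≡match (length A) B A β =
  match-correct bidSide (length A) A B β ≤-refl (buy-legal li)

conserved-bids : ∀ {M B B̂} → UniqueIds B → IsResidue idBid M B B̂ → B̂ ≡ₘ B -ₘ Bids M B
conserved-bids {M} {B} {B̂} U r = subst (B̂ ≡ₘ B -ₘ_) (sym (Bids≡Filled M B)) (residue⇒≡ₘ U r)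

conserved-asks : ∀ {M A Â} → UniqueIds A → IsResidue idAsk M A Â → Â ≡ₘ A -ₘ Asks M A
conserved-asks {M} {A} {Â} U r = subst (Â ≡ₘ A -ₘ_) (sym (Asks≡Filled M A)) (residue⇒≡ₘ U r)

∈-removeId⁻ : ∀ {i S x} → x ∈ removeId i S → x ∈ S
∈-removeId⁻ {i} = proj₁ ∘ ∈-filter⁻ (λ o → ¬? (id o ≟ i))

positive-spread : PositiveBidAskSpread Process-instruction
positive-spread B A (Buy β) li (b , a , b∈ , a∈ , a≤b) =
  Correct.uncrossed (buy-correct li) (a , b , a∈ , b∈ , a≤b)
positive-spread B A (Sell α) li = Correct.uncrossed (sell-correct li)
positive-spread B A (Del i) (¬match , _) (b , a , b∈ , a∈ , a≤b) =
  ¬match (b , a , ∈-removeId⁻ b∈ , ∈-removeId⁻ a∈ , a≤b)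

price-time-priority : PriceTimePriority Process-instruction
price-time-priority B A (Buy β) li =
  Correct.priority (buy-correct li) , incoming-priority bidSide (buy-legal li) (buy-correct li)
price-time-priority B A (Sell α) li =
  incoming-priority askSide (sell-legal li) (sell-correct li) , Correct.priority (sell-correct li)
price-time-priority B A (Del i) _ = (λ _ _ _ ()) , (λ _ _ _ ())

conservation : Conservation Process-instruction
conservation B A (Buy β) li =
  (valid-bid , within-inc , within-rest) ,
  conserved-bids unique-inc residue-inc , conserved-asks unique-rest residue-rest
  where
  open Correct (buy-correct li)
  open Legal (buy-legal li)
  valid-bid : ∀ {t} → t ∈ proj₂ (proj₂ (Match-Bid B A β)) → Valid t (β ∷ B) A
  valid-bid t∈ with valid t∈
  ... | a , b , a∈ , b∈ , t↦a , t↦b , a≤b , bound =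
    b , a , b∈ , a∈ , t↦b , t↦a , a≤b , subst (_ ≤_) (⊓-comm (qty a) (qty b)) bound
conservation B A (Sell α) li =
  (valid , within-rest , within-inc) ,
  conserved-bids unique-rest residue-rest , conserved-asks unique-inc residue-inc
  where
  open Correct (sell-correct li)
  open Legal (sell-legal li)
conservation B A (Del i) (_ , adm) =
  ((λ ()) , (λ _ → z≤n) , (λ _ → z≤n)) ,
  conserved-bids U-B (residue-[] idBid U-B) , conserved-asks U-A (residue-[] idAsk U-A)
  where
  U-B : UniqueIds (removeId i B)
  U-B = Admissible⇒UniqueIdsˡ (removeId i B) adm
  U-A : UniqueIds (removeId i A)
  U-A = Admissible⇒UniqueIdsʳ (removeId i B) adm

theorem3 : PositiveBidAskSpread Process-instruction × PriceTimePriority Process-instruction × Conservation Process-instruction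
theorem3 = positive-spread , price-time-priority , conservation
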